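{- Let $\delta$ be a real with $0<\delta\le1/2$, let $s_\delta\in\mathbb{N}$ satisfy $2^{1-s_\delta}\le\delta$, and let $(m_q)_{q\in\mathbb{N}}$ be integers with $m_q\ge2$ for all $q$. Then for every integer $k\ge0$, $f\big((m_q)_{q=0}^k\big)\le A_2^{(1+k)}\big(5s_\delta\prod_{q=0}^km_q\big)$, where $A_2(x)=2^x$ and $A_2^{(j)}$ denotes the $j$-th iterate of $A_2$.
   Context: For $s\in\mathbb{N}$ let $\Delta_s=\{j/2^s: j\in\mathbb{N},\ 0<j\le2^s\}$. For reals $0<\theta<\varepsilon\le1$ and positive integer $m$, $\Sigma(\theta,\varepsilon,m)=\lceil \frac{m(m-1)}{2(\varepsilon^m-\theta^m)}\rceil$. For $0<\varepsilon\le1$ and a finite sequence $(a_0,\dots,a_j)$ of positive integers, $T_\varepsilon((a_0,\dots,a_j))=\frac{2}{\varepsilon'}\Sigma(\varepsilon'/4,\varepsilon'/2,a_j)$, where $\varepsilon'=\varepsilon$ if $j=0$ and $\varepsilon'=\varepsilon^{\prod_{q=0}^{j-1}a_q}2^{ -2\sum_{l=0}^{j-1}\prod_{q=l}^{j-1}a_q}$ if $j\ge1$. For positive integer $r$, $Q^r_{\theta,\varepsilon}=T_{\frac18(\frac{\varepsilon-\theta}{2^r})^2}$. Define $V_\delta((m_0),\emptyset)=\max_{\varepsilon\in\Delta_{s_\delta}}T_\varepsilon((m_0))$ and, for $k\ge1$, $V_\delta((m_q)_{q=0}^k,(n_q)_{q=0}^{k-1})=\max\{T_{2^{ -s_\delta}}((m_q)_{q=0}^k),\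 \max_{1\le i\le k,\ \theta<\varepsilon\text{ in }\Delta_{s_\delta+k}}Q^{r_i}_{\theta,\varepsilon}((m_q)_{q=i}^k)\}$ with $r_i=\prod_{q=0}^{i-1}n_q$. The map $f$ is defined recursively by $f((m_0))=V_\delta((m_0),\emptyset)$ and, for $k\ge1$, $f((m_q)_{q=0}^k)=V_\delta\big((m_q)_{q=0}^k,\ (f((m_p)_{p=0}^q))_{q=0}^{k-1}\big)$.
   Formalization: The parameter δ is taken over the rationals instead of the reals. -}

module Defs where

open import Data.Bool using (if_then_else_)
open import Data.Nat as ℕ using (ℕ; zero; suc; _<ᵇ_)
open import Data.Integer as ℤ using (ℤ; +_)
open import Data.List using (List; []; _∷_; map; upTo; foldr; concatMap)
open import Data.Nat.ListAction using (product; sum)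
open import Data.Product using (_×_; _,_)
open import Relation.Nullary using (yes; no; does)
open import Data.Rational using (ℚ; 0ℚ; ½; _+_; _*_; _-_; 1/_; _⊔_; ceiling; floor; ≢-nonZero)
  renaming (_/_ to _//_)
open import Data.Rational.Properties using (_≟_; _<?_)

ℕ→ℚ : ℕ → ℚ
ℕ→ℚ n = + n // 1

ℤ→ℚ : ℤ → ℚ
ℤ→ℚ z = z // 1

_^ℚ_ : ℚ → ℕ → ℚ
x ^ℚ zero = ℕ→ℚ 1
x ^ℚ suc n = x * (x ^ℚ n)

-- total reciprocal (agrees with 1/_ on nonzero arguments; only ever
-- applied to nonzero arguments in the definitions below)
inv : ℚ → ℚ
inv p with p ≟ 0ℚ
... | yes _ = 0ℚ
... | no p≢0 = 1/_ p {{≢-nonZero p≢0}}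

-- maximum of a finite list of rationals (all lists used below are
-- nonempty and consist of positive numbers, so the base 0 is harmless)
maxList : List ℚ → ℚ
maxList = foldr _⊔_ 0ℚ

range : ℕ → ℕ → List ℕ
range l j = map (l ℕ.+_) (upTo (j ℕ.∸ l))

prodRange : (ℕ → ℕ) → ℕ → ℕ → ℕ
prodRange a l j = product (map a (range l j))

Δ : ℕ → List ℚ
Δ s = map (λ i → ℕ→ℚ (suc i) * (½ ^ℚ s)) (upTo (2 ℕ.^ s))

ΔPairs : ℕ → List (ℚ × ℚ)
ΔPairs s = concatMap (λ θ → concatMap (λ ε →
             if does (θ <? ε) then (θ , ε) ∷ [] else []) (Δ s)) (Δ s)

Σ' : ℚ → ℚ → ℕ → ℤ
Σ' θ ε m = ceiling (ℕ→ℚ (m ℕ.* (m ℕ.∸ 1)) * inv (ℕ→ℚ 2 * ((ε ^ℚ m) - (θ ^ℚ m))))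

εprime : ℚ → (ℕ → ℕ) → ℕ → ℚ
εprime ε a zero = ε
εprime ε a j@(suc _) =
  (ε ^ℚ prodRange a 0 j)
  * (½ ^ℚ (2 ℕ.* sum (map (λ l → prodRange a l j) (range 0 j))))

T : ℚ → (ℕ → ℕ) → ℕ → ℚ
T ε a j = ℕ→ℚ 2 * inv ε' * ℤ→ℚ (Σ' (ε' * (½ ^ℚ 2)) (ε' * ½) (a j))
  where ε' = εprime ε a j

Q : ℕ → ℚ → ℚ → (ℕ → ℕ) → ℕ → ℚ
Q r θ ε = T ((½ ^ℚ 3) * (((ε - θ) * (½ ^ℚ r)) ^ℚ 2))

-- V_δ, with s = s_δ.  The sequence (m_q)_{q=0}^k is given as m
-- (only m 0 … m k are used), (n_q)_{q=0}^{k-1} as n (only n 0 … n (k-1)).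

V : ℕ → (ℕ → ℕ) → ℕ → (ℕ → ℕ) → ℚ
V s m zero n = maxList (map (λ ε → T ε m 0) (Δ s))
V s m k@(suc _) n =
  T (½ ^ℚ s) m k
  ⊔ maxList (concatMap (λ i → map (λ { (θ , ε) →
        Q (prodRange n 0 i) θ ε (λ q → m (i ℕ.+ q)) (k ℕ.∸ i) })
      (ΔPairs (s ℕ.+ k))) (range 1 (suc k)))

-- f.  The values f((m_p)_{p=0}^q) are fed back into V as the n_q, which
-- the definition of Q^r requires to be positive integers; they are
-- converted to ℕ by ⌊·⌋.

ℚ→ℕ : ℚ → ℕ
ℚ→ℕ x = ℤ.∣ floor x ∣

-- fPrev s m k q = ⌊ f((m_p)_{p=0}^q) ⌋ for q < k
fPrev : ℕ → (ℕ → ℕ) → ℕ → (ℕ → ℕ)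
fPrev s m zero = λ _ → 0
fPrev s m (suc k) = λ q → if q <ᵇ k then fPrev s m k q else ℚ→ℕ (V s m k (fPrev s m k))

f : ℕ → (ℕ → ℕ) → ℕ → ℚ
f s m k = V s m k (fPrev s m k)

A₂iter : ℕ → ℕ → ℕ
A₂iter zero x = x
A₂iter (suc j) x = 2 ℕ.^ A₂iter j x

{-# OPTIONS --safe #-}
-- Every term of V_δ, including each Q, is some T_ε(a), and T_ε(a) ≤ 2 ^ (N + 1 + (N + 3) a_j) as
-- soon as ε′ ≥ 2^-N, because the denominator of Σ(ε′/4, ε′/2, a_j) is at least (ε′/2)^(a_j).
-- Points of Δ_s and gaps ε − θ in Δ_(s+k) are at least 2^-(s+k), and ε′ ≥ ε^P 2^(-2jP) for
-- P = ∏_{q<j} a_q.  The remaining ingredient is r_i = ∏_{q<i} n_q: by strong induction on k,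
-- each n_q = ⌊f((m_p)_{p≤q})⌋ is at most M = A₂^(k)(z) with z = 5 s ∏_{q<k} m_q, so r_i ≤ M^k.
-- Hence every N is at most 3 M^k z, and 2 ^ (N + 1 + (N + 3) m_k) ≤ A₂^(k+1)(z m_k) since the
-- iterated exponential is supermultiplicative.
module Submission where

module ExponentialGrowth where

  open import Data.Nat
  open import Data.Nat.Properties
  open import Data.Product using (_,_)
  open import Relation.Binary.PropositionalEquality
  open import Relation.Nullary.Decidable using (from-yes)
  open import Data.Nat.Solver using (module +-*-Solver)
  open +-*-Solver
  open import Defs using (A₂iter)

  n<2^n : ∀ n → n < 2 ^ n
  n<2^n zero = s≤s z≤n
  n<2^n (suc n) = begin-strict
    suc n         <⟨ s≤s (n<2^n n) ⟩
    suc (2 ^ n)   ≤⟨ +-monoˡ-≤ (2 ^ n) (m^n>0 2 n) ⟩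
    2 ^ n + 2 ^ n ≡⟨ cong (2 ^ n +_) (sym (+-identityʳ (2 ^ n))) ⟩
    2 ^ suc n     ∎
    where open ≤-Reasoning

  48*n≤2^n : ∀ n → 10 ≤ n → 48 * n ≤ 2 ^ n
  48*n≤2^n n 10≤n with m≤n⇒∃[o]m+o≡n 10≤n
  ... | d , refl = go d
    where
    go : ∀ d → 48 * (10 + d) ≤ 2 ^ (10 + d)
    go zero = from-yes (480 ≤? 1024)
    go (suc d) = begin
      48 * (10 + suc d)             ≡⟨ solve 1 (λ d → con 48 :* (con 10 :+ (con 1 :+ d)) := con 48 :+ con 48 :* (con 10 :+ d)) refl d ⟩
      48 + 48 * (10 + d)            ≤⟨ +-monoˡ-≤ (48 * (10 + d)) (*-monoʳ-≤ 48 {1} {10 + d} (s≤s z≤n)) ⟩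
      48 * (10 + d) + 48 * (10 + d) ≤⟨ +-mono-≤ (go d) (go d) ⟩
      2 ^ (10 + d) + 2 ^ (10 + d)   ≡⟨ cong (2 ^ (10 + d) +_) (sym (+-identityʳ _)) ⟩
      2 ^ suc (10 + d)              ∎
      where open ≤-Reasoning

  m+n≤m*n : ∀ {m n} → 2 ≤ m → 2 ≤ n → m + n ≤ m * n
  m+n≤m*n {suc (suc m)} {suc (suc n)} (s≤s (s≤s z≤n)) (s≤s (s≤s z≤n)) = begin
    2 + m + (2 + n)                       ≤⟨ m≤m+n (2 + m + (2 + n)) (m + n + m * n) ⟩
    2 + m + (2 + n) + (m + n + m * n)     ≡⟨ solve 2 (λ m n → (con 2 :+ m) :+ (con 2 :+ n) :+ (m :+ n :+ m :* n) := (con 2 :+ m) :* (con 2 :+ n)) refl m n ⟩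
    (2 + m) * (2 + n)                     ∎
    where open ≤-Reasoning

  tExponent : ℕ → ℕ → ℕ
  tExponent N m = N + 1 + (N + 3) * m

  2^[1+N]*m[m∸1]*2^[[N+1]m]≤2^tExponent : ∀ N m →
    2 ^ suc N * (m * (m ∸ 1) * 2 ^ ((N + 1) * m)) ≤ 2 ^ tExponent N m
  2^[1+N]*m[m∸1]*2^[[N+1]m]≤2^tExponent N m = begin
    2 ^ suc N * (m * (m ∸ 1) * 2 ^ ((N + 1) * m)) ≤⟨ *-monoʳ-≤ (2 ^ suc N) (*-monoˡ-≤ (2 ^ ((N + 1) * m)) m[m∸1]≤2^[m+m]) ⟩
    2 ^ suc N * (2 ^ (m + m) * 2 ^ ((N + 1) * m)) ≡⟨ cong (2 ^ suc N *_) (sym (^-distribˡ-+-* 2 (m + m) ((N + 1) * m))) ⟩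
    2 ^ suc N * 2 ^ (m + m + (N + 1) * m)         ≡⟨ sym (^-distribˡ-+-* 2 (suc N) (m + m + (N + 1) * m)) ⟩
    2 ^ (suc N + (m + m + (N + 1) * m))           ≡⟨ cong (2 ^_) (solve 2 (λ N m → (con 1 :+ N) :+ (m :+ m :+ (N :+ con 1) :* m) := N :+ con 1 :+ (N :+ con 3) :* m) refl N m) ⟩
    2 ^ tExponent N m                             ∎
    where
    open ≤-Reasoning
    m[m∸1]≤2^[m+m] : m * (m ∸ 1) ≤ 2 ^ (m + m)
    m[m∸1]≤2^[m+m] = begin
      m * (m ∸ 1)   ≤⟨ *-mono-≤ (<⇒≤ (n<2^n m)) (≤-trans (m∸n≤m m 1) (<⇒≤ (n<2^n m))) ⟩
      2 ^ m * 2 ^ m ≡⟨ sym (^-distribˡ-+-* 2 m m) ⟩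
      2 ^ (m + m)   ∎

  tExponent≤5*s*u : ∀ {s u} → 2 ≤ s → 2 ≤ u → tExponent s u ≤ 5 * s * u
  tExponent≤5*s*u {suc (suc a)} {suc (suc b)} (s≤s (s≤s z≤n)) (s≤s (s≤s z≤n)) = begin
    tExponent (2 + a) (2 + b)                                   ≤⟨ m≤m+n _ (7 + 7 * a + 5 * b + 4 * a * b) ⟩
    tExponent (2 + a) (2 + b) + (7 + 7 * a + 5 * b + 4 * a * b)
      ≡⟨ solve 2 (λ a b → (con 2 :+ a) :+ con 1 :+ ((con 2 :+ a) :+ con 3) :* (con 2 :+ b) :+ (con 7 :+ con 7 :* a :+ con 5 :* b :+ con 4 :* a :* b)
                          := con 5 :* (con 2 :+ a) :* (con 2 :+ b)) refl a b ⟩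
    5 * (2 + a) * (2 + b)                                       ∎
    where open ≤-Reasoning

  3+2s+4k≤5*s*P : ∀ {s} k {P} → 2 ≤ s → suc k ≤ P → 3 + 2 * s + 4 * k ≤ 5 * s * P
  3+2s+4k≤5*s*P {suc (suc a)} k {P} (s≤s (s≤s z≤n)) 1+k≤P = begin
    3 + 2 * (2 + a) + 4 * k                                   ≤⟨ m≤m+n _ (3 + 6 * k + 3 * a + 5 * a * k) ⟩
    3 + 2 * (2 + a) + 4 * k + (3 + 6 * k + 3 * a + 5 * a * k)
      ≡⟨ solve 2 (λ a k → con 3 :+ con 2 :* (con 2 :+ a) :+ con 4 :* k :+ (con 3 :+ con 6 :* k :+ con 3 :* a :+ con 5 :* a :* k)
                          := con 5 :* (con 2 :+ a) :* (con 1 :+ k)) refl a k ⟩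
    5 * (2 + a) * (1 + k)                                     ≤⟨ *-monoʳ-≤ (5 * (2 + a)) 1+k≤P ⟩
    5 * (2 + a) * P                                           ∎
    where open ≤-Reasoning

  A₂iter-inflationary : ∀ j x → x ≤ A₂iter j x
  A₂iter-inflationary zero x = ≤-refl
  A₂iter-inflationary (suc j) x = ≤-trans (A₂iter-inflationary j x) (<⇒≤ (n<2^n (A₂iter j x)))

  A₂iter-monoʳ-≤ : ∀ j {x y} → x ≤ y → A₂iter j x ≤ A₂iter j y
  A₂iter-monoʳ-≤ zero x≤y = x≤y
  A₂iter-monoʳ-≤ (suc j) x≤y = ^-monoʳ-≤ 2 (A₂iter-monoʳ-≤ j x≤y)

  A₂iter-monoˡ-≤ : ∀ x {i j} → i ≤ j → A₂iter i x ≤ A₂iter j x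
  A₂iter-monoˡ-≤ x {i} i≤j = go (≤⇒≤′ i≤j)
    where
    go : ∀ {j} → i ≤′ j → A₂iter i x ≤ A₂iter j x
    go ≤′-refl = ≤-refl
    go (≤′-step i≤′j) = ≤-trans (go i≤′j) (<⇒≤ (n<2^n _))

  2^x≤A₂iter : ∀ j x → 2 ^ x ≤ A₂iter (suc j) x
  2^x≤A₂iter j x = ^-monoʳ-≤ 2 (A₂iter-inflationary j x)

  A₂iter-supermultiplicative : ∀ j {a b} → 1 ≤ a → 1 ≤ b →
    A₂iter (suc j) a * A₂iter (suc j) b ≤ A₂iter (suc j) (a + b)
  A₂iter-supermultiplicative zero {a} {b} _ _ = ≤-reflexive (sym (^-distribˡ-+-* 2 a b))
  A₂iter-supermultiplicative (suc j) {a} {b} 1≤a 1≤b = begin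
    2 ^ A₂iter (suc j) a * 2 ^ A₂iter (suc j) b ≡⟨ sym (^-distribˡ-+-* 2 (A₂iter (suc j) a) (A₂iter (suc j) b)) ⟩
    2 ^ (A₂iter (suc j) a + A₂iter (suc j) b)   ≤⟨ ^-monoʳ-≤ 2 (≤-trans (m+n≤m*n (2≤A 1≤a) (2≤A 1≤b)) (A₂iter-supermultiplicative j 1≤a 1≤b)) ⟩
    2 ^ A₂iter (suc j) (a + b)                  ∎
    where
    open ≤-Reasoning
    2≤A : ∀ {x} → 1 ≤ x → 2 ≤ A₂iter (suc j) x
    2≤A {x} 1≤x = ≤-trans (^-monoʳ-≤ 2 1≤x) (2^x≤A₂iter j x)

  w+A₂iter*[1+j]≤A₂iter[z+w] : ∀ j {z w} → 2 + j ≤ z → 10 ≤ w → z ≤ w →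
    w + A₂iter j z * suc j ≤ A₂iter j (z + w)
  w+A₂iter*[1+j]≤A₂iter[z+w] zero {z} {w} _ _ _ = ≤-reflexive (trans (cong (w +_) (*-identityʳ z)) (+-comm w z))
  w+A₂iter*[1+j]≤A₂iter[z+w] (suc i) {z} {w} 2+j≤z 10≤w z≤w = begin
    w + Az * (2 + i)          ≤⟨ +-monoˡ-≤ (Az * (2 + i)) (m≤n*m w Az) ⟩
    Az * w + Az * (2 + i)     ≡⟨ sym (*-distribˡ-+ Az w (2 + i)) ⟩
    Az * (w + (2 + i))        ≤⟨ *-monoʳ-≤ Az w+2+i≤Aw ⟩
    Az * A₂iter (suc i) w     ≤⟨ A₂iter-supermultiplicative i (≤-trans (s≤s z≤n) 2+j≤z) (≤-trans (s≤s z≤n) 10≤w) ⟩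
    A₂iter (suc i) (z + w)    ∎
    where
    open ≤-Reasoning
    Az = A₂iter (suc i) z
    instance
      Az≢0 : NonZero Az
      Az≢0 = >-nonZero (≤-trans (≤-trans (s≤s z≤n) 2+j≤z) (A₂iter-inflationary (suc i) z))
    w+2+i≤Aw : w + (2 + i) ≤ A₂iter (suc i) w
    w+2+i≤Aw = begin
      w + (2 + i)  ≤⟨ +-monoʳ-≤ w (≤-trans (n≤1+n _) (≤-trans 2+j≤z z≤w)) ⟩
      w + w        ≡⟨ cong (w +_) (sym (+-identityʳ w)) ⟩
      2 * w        ≤⟨ *-monoˡ-≤ w {2} {48} (s≤s (s≤s z≤n)) ⟩
      48 * w       ≤⟨ 48*n≤2^n w 10≤w ⟩
      2 ^ w        ≤⟨ 2^x≤A₂iter i w ⟩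
      A₂iter (suc i) w ∎

  -- With u = 2 + v and w = z * (1 + v), z * u = z + w: the factor 24 * (z * u) is absorbed
  -- by 2 ^ w and M ^ (1 + j) = 2 ^ (A₂iter j z * (1 + j)) by w+A₂iter*[1+j]≤A₂iter[z+w].
  tExponent≤A₂iter : ∀ j {z u N} → 2 ≤ u → 10 ≤ z → 2 + j ≤ z →
    N ≤ 3 * A₂iter (suc j) z ^ suc j * z → tExponent N u ≤ A₂iter (suc j) (z * u)
  tExponent≤A₂iter j {z} {u@(suc (suc v))} {N} (s≤s (s≤s z≤n)) 10≤z 2+j≤z N≤ = begin
    tExponent N u                          ≤⟨ m≤m+n (tExponent N u) (9 * N + 5 + 5 * v * N + 3 * v) ⟩
    tExponent N u + (9 * N + 5 + 5 * v * N + 3 * v)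
      ≡⟨ solve 2 (λ N v → N :+ con 1 :+ (N :+ con 3) :* (con 2 :+ v) :+ (con 9 :* N :+ con 5 :+ con 5 :* v :* N :+ con 3 :* v)
                          := con 6 :* (con 2 :+ v) :* (N :+ con 1)) refl N v ⟩
    6 * u * (N + 1)                        ≤⟨ *-monoʳ-≤ (6 * u) N+1≤ ⟩
    6 * u * (4 * Mʲ * z)                   ≡⟨ solve 3 (λ u Mʲ z → con 6 :* u :* (con 4 :* Mʲ :* z) := (con 24 :* (z :* u)) :* Mʲ) refl u Mʲ z ⟩
    24 * (z * u) * Mʲ                      ≤⟨ *-monoˡ-≤ Mʲ 24zu≤2^w ⟩
    2 ^ w * Mʲ                             ≡⟨ cong (2 ^ w *_) (^-*-assoc 2 (A₂iter j z) (suc j)) ⟩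
    2 ^ w * 2 ^ (A₂iter j z * suc j)       ≡⟨ sym (^-distribˡ-+-* 2 w _) ⟩
    2 ^ (w + A₂iter j z * suc j)           ≤⟨ ^-monoʳ-≤ 2 (w+A₂iter*[1+j]≤A₂iter[z+w] j 2+j≤z 10≤w z≤w) ⟩
    2 ^ A₂iter j (z + w)                   ≡⟨ cong (λ t → 2 ^ A₂iter j t) (sym (*-suc z (suc v))) ⟩
    A₂iter (suc j) (z * u)                 ∎
    where
    open ≤-Reasoning
    M = A₂iter (suc j) z
    Mʲ = M ^ suc j
    w = z * suc v
    z≤w : z ≤ w
    z≤w = m≤m*n z (suc v)
    10≤w : 10 ≤ w
    10≤w = ≤-trans 10≤z z≤w
    instance
      M≢0 : NonZero M
      M≢0 = >-nonZero (≤-trans (≤-trans (s≤s z≤n) 10≤z) (A₂iter-inflationary (suc j) z))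
    1≤Mʲz : 1 ≤ Mʲ * z
    1≤Mʲz = *-mono-≤ (m^n>0 M (suc j)) (≤-trans (s≤s z≤n) 10≤z)
    N+1≤ : N + 1 ≤ 4 * Mʲ * z
    N+1≤ = begin
      N + 1                 ≤⟨ +-mono-≤ N≤ 1≤Mʲz ⟩
      3 * Mʲ * z + Mʲ * z   ≡⟨ solve 2 (λ a b → con 3 :* a :* b :+ a :* b := con 4 :* a :* b) refl Mʲ z ⟩
      4 * Mʲ * z            ∎
    24zu≤2^w : 24 * (z * u) ≤ 2 ^ w
    24zu≤2^w = begin
      24 * (z * u)  ≡⟨ cong (24 *_) (*-suc z (suc v)) ⟩
      24 * (z + w)  ≤⟨ *-monoʳ-≤ 24 (+-monoˡ-≤ w z≤w) ⟩
      24 * (w + w)  ≡⟨ solve 1 (λ w → con 24 :* (w :+ w) := con 48 :* w) refl w ⟩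
      48 * w        ≤⟨ 48*n≤2^n w 10≤w ⟩
      2 ^ w         ∎

module RangeProducts where

  open import Data.Nat
  open import Data.Nat.Properties
  open import Data.Nat.ListAction using (product; sum)
  open import Data.List using (List; []; _∷_; map; applyUpTo; length)
  open import Data.List.Properties using (map-applyUpTo; length-map; length-upTo)
  open import Data.List.Membership.Propositional using (_∈_)
  open import Data.List.Membership.Propositional.Properties using (∈-map⁻; ∈-upTo⁻)
  open import Data.List.Relation.Unary.Any using (here; there)
  open import Data.Product using (_,_)
  open import Function using (id; _∘_)
  open import Relation.Binary.PropositionalEquality
  open import Defs using (range; prodRange)

  private
    prodUpTo : (ℕ → ℕ) → ℕ → ℕ
    prodUpTo a n = product (applyUpTo a n)

    prodUpTo-+ : ∀ a i j → prodUpTo a (i + j) ≡ prodUpTo a i * prodUpTo (λ t → a (i + t)) j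
    prodUpTo-+ a zero j = sym (+-identityʳ _)
    prodUpTo-+ a (suc i) j = trans (cong (a 0 *_) (prodUpTo-+ (a ∘ suc) i j)) (sym (*-assoc (a 0) _ _))

    prodUpTo-pos : ∀ a n → (∀ t → 1 ≤ a t) → 1 ≤ prodUpTo a n
    prodUpTo-pos a zero _ = ≤-refl
    prodUpTo-pos a (suc n) 1≤a = *-mono-≤ (1≤a 0) (prodUpTo-pos (a ∘ suc) n (1≤a ∘ suc))

    1+n≤prodUpTo : ∀ a n → (∀ t → 2 ≤ a t) → suc n ≤ prodUpTo a n
    1+n≤prodUpTo a zero _ = ≤-refl
    1+n≤prodUpTo a (suc n) 2≤a = begin
      2 + n  ≤⟨ s≤s (1+n≤prodUpTo (a ∘ suc) n (2≤a ∘ suc)) ⟩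
      1 + P  ≤⟨ +-monoˡ-≤ P (prodUpTo-pos (a ∘ suc) n (λ t → ≤-trans (s≤s z≤n) (2≤a (suc t)))) ⟩
      P + P  ≡⟨ cong (P +_) (sym (+-identityʳ P)) ⟩
      2 * P  ≤⟨ *-monoˡ-≤ P (2≤a 0) ⟩
      a 0 * P ∎
      where
      open ≤-Reasoning
      P = prodUpTo (a ∘ suc) n

    prodUpTo≤^ : ∀ a n M → (∀ t → t < n → a t ≤ M) → prodUpTo a n ≤ M ^ n
    prodUpTo≤^ a zero M _ = ≤-refl
    prodUpTo≤^ a (suc n) M a≤M = *-mono-≤ (a≤M 0 (s≤s z≤n)) (prodUpTo≤^ (a ∘ suc) n M (λ t t<n → a≤M (suc t) (s≤s t<n)))

    prodRange≡prodUpTo : ∀ a l j → prodRange a l j ≡ prodUpTo (λ t → a (l + t)) (j ∸ l)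
    prodRange≡prodUpTo a l j =
      cong product (trans (cong (map a) (map-applyUpTo id (l +_) (j ∸ l))) (map-applyUpTo (l +_) a (j ∸ l)))

  prodRange-shift : ∀ a l j → prodRange a l j ≡ prodRange (λ q → a (l + q)) 0 (j ∸ l)
  prodRange-shift a l j = trans (prodRange≡prodUpTo a l j) (sym (prodRange≡prodUpTo (λ q → a (l + q)) 0 (j ∸ l)))

  prodRange-split : ∀ a {l j} → l ≤ j → prodRange a 0 j ≡ prodRange a 0 l * prodRange a l j
  prodRange-split a {l} {j} l≤j = begin
    prodRange a 0 j                                      ≡⟨ prodRange≡prodUpTo a 0 j ⟩
    prodUpTo a j                                         ≡⟨ cong (prodUpTo a) (sym (m+[n∸m]≡n l≤j)) ⟩
    prodUpTo a (l + (j ∸ l))                             ≡⟨ prodUpTo-+ a l (j ∸ l) ⟩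
    prodUpTo a l * prodUpTo (λ t → a (l + t)) (j ∸ l)    ≡⟨ sym (cong₂ _*_ (prodRange≡prodUpTo a 0 l) (prodRange≡prodUpTo a l j)) ⟩
    prodRange a 0 l * prodRange a l j                    ∎
    where open ≡-Reasoning

  prodRange-suc : ∀ a k → prodRange a 0 (suc k) ≡ prodRange a 0 k * a k
  prodRange-suc a k = begin
    prodRange a 0 (suc k)                   ≡⟨ prodRange-split a (n≤1+n k) ⟩
    prodRange a 0 k * prodRange a k (suc k) ≡⟨ cong (prodRange a 0 k *_) last-factor ⟩
    prodRange a 0 k * a k                   ∎
    where
    open ≡-Reasoning
    last-factor : prodRange a k (suc k) ≡ a k
    last-factor = begin
      prodRange a k (suc k)                 ≡⟨ prodRange≡prodUpTo a k (suc k) ⟩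
      prodUpTo (λ t → a (k + t)) (suc k ∸ k) ≡⟨ cong (prodUpTo (λ t → a (k + t))) (m+n∸n≡m 1 k) ⟩
      a (k + 0) * 1                         ≡⟨ trans (*-identityʳ _) (cong a (+-identityʳ k)) ⟩
      a k                                   ∎

  prodRange-pos : ∀ a l j → (∀ t → 1 ≤ a t) → 1 ≤ prodRange a l j
  prodRange-pos a l j 1≤a rewrite prodRange≡prodUpTo a l j = prodUpTo-pos (λ t → a (l + t)) (j ∸ l) (1≤a ∘ (l +_))

  1+k≤prodRange : ∀ a k → (∀ t → 2 ≤ a t) → suc k ≤ prodRange a 0 k
  1+k≤prodRange a k 2≤a rewrite prodRange≡prodUpTo a 0 k = 1+n≤prodUpTo a k 2≤a

  prodRange≤^ : ∀ a k M → (∀ t → t < k → a t ≤ M) → prodRange a 0 k ≤ M ^ k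
  prodRange≤^ a k M a≤M rewrite prodRange≡prodUpTo a 0 k = prodUpTo≤^ a k M a≤M

  prodRange-prefix≤ : ∀ a {l j} → (∀ t → 1 ≤ a t) → l ≤ j → prodRange a 0 l ≤ prodRange a 0 j
  prodRange-prefix≤ a {l} {j} 1≤a l≤j rewrite prodRange-split a l≤j =
    m≤m*n (prodRange a 0 l) (prodRange a l j) {{>-nonZero (prodRange-pos a l j 1≤a)}}

  prodRange-suffix≤ : ∀ a {l j} → (∀ t → 1 ≤ a t) → l ≤ j → prodRange a l j ≤ prodRange a 0 j
  prodRange-suffix≤ a {l} {j} 1≤a l≤j rewrite prodRange-split a l≤j =
    m≤n*m (prodRange a l j) (prodRange a 0 l) {{>-nonZero (prodRange-pos a 0 l 1≤a)}}

  sum-map≤length* : ∀ {A : Set} (g : A → ℕ) (xs : List A) {B} → (∀ {x} → x ∈ xs → g x ≤ B) →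
    sum (map g xs) ≤ length xs * B
  sum-map≤length* g [] _ = z≤n
  sum-map≤length* g (x ∷ xs) g≤B = +-mono-≤ (g≤B (here refl)) (sum-map≤length* g xs (g≤B ∘ there))

  sum-prodRange-suffix≤ : ∀ a j → (∀ t → 1 ≤ a t) →
    sum (map (λ l → prodRange a l j) (range 0 j)) ≤ j * prodRange a 0 j
  sum-prodRange-suffix≤ a j 1≤a =
    subst (λ n → sum (map (λ l → prodRange a l j) (range 0 j)) ≤ n * prodRange a 0 j) (trans (length-map (0 +_) (applyUpTo id j)) (length-upTo j))
      (sum-map≤length* (λ l → prodRange a l j) (range 0 j) suffix≤)
    where
    suffix≤ : ∀ {l} → l ∈ range 0 j → prodRange a l j ≤ prodRange a 0 j
    suffix≤ l∈ with ∈-map⁻ (0 +_) l∈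
    ... | l , l∈upTo , refl = prodRange-suffix≤ a 1≤a (<⇒≤ (∈-upTo⁻ l∈upTo))

module RationalArithmetic where

  open import Data.Nat as ℕ using (ℕ; zero; suc)
  import Data.Nat.Properties as ℕP
  open import Data.Integer as ℤ using (ℤ; +_; -[1+_])
  import Data.Integer.Properties as ℤP
  open import Data.Rational
  open import Data.Rational.Properties
  import Data.Rational.Unnormalised as ℚᵘ
  import Data.Rational.Unnormalised.Properties as ℚᵘP
  open import Data.Rational.Solver using (module +-*-Solver)
  open +-*-Solver
  import Data.Nat.Coprimality as C
  open import Data.Empty using (⊥-elim)
  open import Relation.Nullary using (yes; no)
  open import Relation.Binary.PropositionalEquality
  open import Defs using (ℕ→ℚ; ℤ→ℚ; _^ℚ_; inv)

  ℕ→ℚ≡mkℚ : ∀ n → ℕ→ℚ n ≡ mkℚ (+ n) 0 (C.sym (C.1-coprimeTo n))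
  ℕ→ℚ≡mkℚ n = normalize-coprime (C.sym (C.1-coprimeTo n))

  ℕ→ℚ-mono-≤ : ∀ {a b} → a ℕ.≤ b → ℕ→ℚ a ≤ ℕ→ℚ b
  ℕ→ℚ-mono-≤ {a} {b} a≤b rewrite ℕ→ℚ≡mkℚ a | ℕ→ℚ≡mkℚ b =
    *≤* (subst₂ ℤ._≤_ (sym (ℤP.*-identityʳ (+ a))) (sym (ℤP.*-identityʳ (+ b))) (ℤ.+≤+ a≤b))

  0≤ℕ→ℚ : ∀ n → 0ℚ ≤ ℕ→ℚ n
  0≤ℕ→ℚ n = ℕ→ℚ-mono-≤ {0} {n} ℕ.z≤n

  ℕ→ℚ-homo-* : ∀ a b → ℕ→ℚ (a ℕ.* b) ≡ ℕ→ℚ a * ℕ→ℚ b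
  ℕ→ℚ-homo-* a b = toℚᵘ-injective (ℚᵘP.≃-trans homo (ℚᵘP.≃-sym (toℚᵘ-homo-* (ℕ→ℚ a) (ℕ→ℚ b))))
    where
    homo : toℚᵘ (ℕ→ℚ (a ℕ.* b)) ℚᵘ.≃ toℚᵘ (ℕ→ℚ a) ℚᵘ.* toℚᵘ (ℕ→ℚ b)
    homo rewrite ℕ→ℚ≡mkℚ a | ℕ→ℚ≡mkℚ b | ℕ→ℚ≡mkℚ (a ℕ.* b) = ℚᵘ.*≡* (cong (ℤ._* + 1) (ℤP.pos-* a b))

  ℕ→ℚ-homo-+ : ∀ a b → ℕ→ℚ (a ℕ.+ b) ≡ ℕ→ℚ a + ℕ→ℚ b
  ℕ→ℚ-homo-+ a b = toℚᵘ-injective (ℚᵘP.≃-trans homo (ℚᵘP.≃-sym (toℚᵘ-homo-+ (ℕ→ℚ a) (ℕ→ℚ b))))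
    where
    homo : toℚᵘ (ℕ→ℚ (a ℕ.+ b)) ℚᵘ.≃ toℚᵘ (ℕ→ℚ a) ℚᵘ.+ toℚᵘ (ℕ→ℚ b)
    homo rewrite ℕ→ℚ≡mkℚ a | ℕ→ℚ≡mkℚ b | ℕ→ℚ≡mkℚ (a ℕ.+ b) =
      ℚᵘ.*≡* (cong (ℤ._* + 1) (trans (ℤP.pos-+ a b) (sym (cong₂ ℤ._+_ (ℤP.*-identityʳ (+ a)) (ℤP.*-identityʳ (+ b))))))

  ℤ→ℚ≡mkℚ : ∀ z → ℤ→ℚ z ≡ mkℚ z 0 (C.sym (C.1-coprimeTo ℤ.∣ z ∣))
  ℤ→ℚ≡mkℚ (+ n) = ℕ→ℚ≡mkℚ n
  ℤ→ℚ≡mkℚ -[1+ n ] = cong -_ (ℕ→ℚ≡mkℚ (suc n))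

  ℤ→ℚ-≤-ℕ→ℚ : ∀ {z} c → z ℤ.≤ + c → ℤ→ℚ z ≤ ℕ→ℚ c
  ℤ→ℚ-≤-ℕ→ℚ {z} c z≤c rewrite ℤ→ℚ≡mkℚ z | ℕ→ℚ≡mkℚ c =
    *≤* (subst₂ ℤ._≤_ (sym (ℤP.*-identityʳ z)) (sym (ℤP.*-identityʳ (+ c))) z≤c)

  0<½ : 0ℚ < ½
  0<½ = *<* (ℤ.+<+ (ℕ.s≤s ℕ.z≤n))

  0<p*q : ∀ {p q} → 0ℚ < p → 0ℚ < q → 0ℚ < p * q
  0<p*q {p} {q} 0<p 0<q = positive⁻¹ (p * q) {{pos*pos⇒pos p {{positive 0<p}} q {{positive 0<q}}}}

  0≤p*q : ∀ {p q} → 0ℚ ≤ p → 0ℚ ≤ q → 0ℚ ≤ p * q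
  0≤p*q {p} {q} 0≤p 0≤q = nonNegative⁻¹ (p * q) {{nonNeg*nonNeg⇒nonNeg p {{nonNegative 0≤p}} q {{nonNegative 0≤q}}}}

  *-mono-≤-nonNeg : ∀ {a b c d} → 0ℚ ≤ a → a ≤ b → 0ℚ ≤ d → c ≤ d → a * c ≤ b * d
  *-mono-≤-nonNeg {a} {b} {c} {d} 0≤a a≤b 0≤d c≤d =
    ≤-trans (*-monoˡ-≤-nonNeg a {{nonNegative 0≤a}} c≤d) (*-monoʳ-≤-nonNeg d {{nonNegative 0≤d}} a≤b)

  ^ℚ-distribʳ-* : ∀ x y n → (x * y) ^ℚ n ≡ (x ^ℚ n) * (y ^ℚ n)
  ^ℚ-distribʳ-* x y zero = refl
  ^ℚ-distribʳ-* x y (suc n) = trans (cong ((x * y) *_) (^ℚ-distribʳ-* x y n)) (interchange x y (x ^ℚ n) (y ^ℚ n))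
    where
    interchange : ∀ a b c d → (a * b) * (c * d) ≡ (a * c) * (b * d)
    interchange = solve 4 (λ a b c d → (a :* b) :* (c :* d) := (a :* c) :* (b :* d)) refl

  ^ℚ-distribˡ-+-* : ∀ x a b → x ^ℚ (a ℕ.+ b) ≡ (x ^ℚ a) * (x ^ℚ b)
  ^ℚ-distribˡ-+-* x zero b = sym (*-identityˡ _)
  ^ℚ-distribˡ-+-* x (suc a) b = trans (cong (x *_) (^ℚ-distribˡ-+-* x a b)) (sym (*-assoc x _ _))

  ^ℚ-*-assoc : ∀ x a b → (x ^ℚ a) ^ℚ b ≡ x ^ℚ (a ℕ.* b)
  ^ℚ-*-assoc x zero b = 1^ℚ b
    where
    1^ℚ : ∀ b → ℕ→ℚ 1 ^ℚ b ≡ ℕ→ℚ 1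
    1^ℚ zero = refl
    1^ℚ (suc b) = trans (*-identityˡ _) (1^ℚ b)
  ^ℚ-*-assoc x (suc a) b = begin
    (x * x ^ℚ a) ^ℚ b          ≡⟨ ^ℚ-distribʳ-* x (x ^ℚ a) b ⟩
    x ^ℚ b * (x ^ℚ a) ^ℚ b     ≡⟨ cong (x ^ℚ b *_) (^ℚ-*-assoc x a b) ⟩
    x ^ℚ b * x ^ℚ (a ℕ.* b)    ≡⟨ sym (^ℚ-distribˡ-+-* x b (a ℕ.* b)) ⟩
    x ^ℚ (b ℕ.+ a ℕ.* b)       ∎
    where open ≡-Reasoning

  ^ℚ-nonNeg : ∀ {x} n → 0ℚ ≤ x → 0ℚ ≤ x ^ℚ n
  ^ℚ-nonNeg zero _ = *≤* (ℤ.+≤+ ℕ.z≤n)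
  ^ℚ-nonNeg (suc n) 0≤x = 0≤p*q 0≤x (^ℚ-nonNeg n 0≤x)

  ^ℚ-monoˡ-≤ : ∀ {x y} n → 0ℚ ≤ x → x ≤ y → x ^ℚ n ≤ y ^ℚ n
  ^ℚ-monoˡ-≤ zero _ _ = ≤-refl
  ^ℚ-monoˡ-≤ {x} {y} (suc n) 0≤x x≤y =
    *-mono-≤-nonNeg 0≤x x≤y (^ℚ-nonNeg n (≤-trans 0≤x x≤y)) (^ℚ-monoˡ-≤ n 0≤x x≤y)

  ½^-pos : ∀ n → 0ℚ < ½ ^ℚ n
  ½^-pos zero = *<* (ℤ.+<+ (ℕ.s≤s ℕ.z≤n))
  ½^-pos (suc n) = 0<p*q 0<½ (½^-pos n)

  0≤½^ : ∀ n → 0ℚ ≤ ½ ^ℚ n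
  0≤½^ n = <⇒≤ (½^-pos n)

  ½^≤1 : ∀ n → ½ ^ℚ n ≤ 1ℚ
  ½^≤1 zero = ≤-refl
  ½^≤1 (suc n) = ≤-trans (*-mono-≤-nonNeg (<⇒≤ 0<½) ≤-refl (*≤* (ℤ.+≤+ ℕ.z≤n)) (½^≤1 n)) (*≤* (ℤ.+≤+ (ℕ.s≤s ℕ.z≤n)))

  ½^[1+n]≤½ : ∀ n → ½ ^ℚ suc n ≤ ½
  ½^[1+n]≤½ n = ≤-trans (*-monoˡ-≤-nonNeg ½ {{nonNegative (<⇒≤ 0<½)}} (½^≤1 n)) (≤-reflexive (*-identityʳ ½))

  ½^-antimono-≤ : ∀ {a b} → a ℕ.≤ b → ½ ^ℚ b ≤ ½ ^ℚ a
  ½^-antimono-≤ {a} {b} a≤b = begin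
    ½ ^ℚ b                         ≡⟨ cong (½ ^ℚ_) (sym (ℕP.m+[n∸m]≡n a≤b)) ⟩
    ½ ^ℚ (a ℕ.+ (b ℕ.∸ a))         ≡⟨ ^ℚ-distribˡ-+-* ½ a (b ℕ.∸ a) ⟩
    ½ ^ℚ a * ½ ^ℚ (b ℕ.∸ a)        ≤⟨ *-monoˡ-≤-nonNeg (½ ^ℚ a) {{nonNegative (0≤½^ a)}} (½^≤1 (b ℕ.∸ a)) ⟩
    ½ ^ℚ a * 1ℚ                    ≡⟨ *-identityʳ _ ⟩
    ½ ^ℚ a                         ∎
    where open ≤-Reasoning

  ½^n*2^n≡1 : ∀ n → ½ ^ℚ n * ℕ→ℚ (2 ℕ.^ n) ≡ 1ℚ
  ½^n*2^n≡1 zero = refl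
  ½^n*2^n≡1 (suc n) = begin
    (½ * ½ ^ℚ n) * ℕ→ℚ (2 ℕ.* 2 ℕ.^ n)     ≡⟨ cong ((½ * ½ ^ℚ n) *_) (ℕ→ℚ-homo-* 2 (2 ℕ.^ n)) ⟩
    (½ * ½ ^ℚ n) * (ℕ→ℚ 2 * ℕ→ℚ (2 ℕ.^ n)) ≡⟨ solve 3 (λ h p q → (h :* p) :* (con 2ℚ :* q) := (h :* con 2ℚ) :* (p :* q)) refl ½ (½ ^ℚ n) (ℕ→ℚ (2 ℕ.^ n)) ⟩
    (½ * ℕ→ℚ 2) * (½ ^ℚ n * ℕ→ℚ (2 ℕ.^ n)) ≡⟨ cong ((½ * ℕ→ℚ 2) *_) (½^n*2^n≡1 n) ⟩
    1ℚ                                     ∎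
    where
    open ≡-Reasoning
    2ℚ = ℕ→ℚ 2

  ½^≤⇒pos : ∀ a {x} → ½ ^ℚ a ≤ x → 0ℚ < x
  ½^≤⇒pos a ½^a≤x = <-≤-trans (½^-pos a) ½^a≤x

  ½^≤-* : ∀ a b {x y} → ½ ^ℚ a ≤ x → ½ ^ℚ b ≤ y → ½ ^ℚ (a ℕ.+ b) ≤ x * y
  ½^≤-* a b ½^a≤x ½^b≤y = subst (_≤ _) (sym (^ℚ-distribˡ-+-* ½ a b))
    (*-mono-≤-nonNeg (0≤½^ a) ½^a≤x (<⇒≤ (½^≤⇒pos b ½^b≤y)) ½^b≤y)

  ½^≤-^ : ∀ a n {x} → ½ ^ℚ a ≤ x → ½ ^ℚ (a ℕ.* n) ≤ x ^ℚ n
  ½^≤-^ a n ½^a≤x = subst (_≤ _) (^ℚ-*-assoc ½ a n) (^ℚ-monoˡ-≤ n (0≤½^ a) ½^a≤x)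

  0≤1/ : ∀ x .{{_ : NonZero x}} → 0ℚ ≤ x → 0ℚ ≤ 1/ x
  0≤1/ x 0≤x = <⇒≤ (positive⁻¹ _ {{1/pos⇒pos x {{nonNeg∧nonZero⇒pos x {{nonNegative 0≤x}}}}}})

  inv-nonNeg : ∀ {x} → 0ℚ ≤ x → 0ℚ ≤ inv x
  inv-nonNeg {x} 0≤x with x ≟ 0ℚ
  ... | yes _ = ≤-refl
  ... | no x≢0 = 0≤1/ x {{≢-nonZero x≢0}} 0≤x

  inv≤2^ : ∀ {x} n → ½ ^ℚ n ≤ x → inv x ≤ ℕ→ℚ (2 ℕ.^ n)
  inv≤2^ {x} n ½^n≤x with x ≟ 0ℚ
  ... | yes refl = ⊥-elim (<-irrefl refl (½^≤⇒pos n ½^n≤x))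
  ... | no x≢0 = begin
    x⁻¹                      ≡⟨ sym (*-identityʳ x⁻¹) ⟩
    x⁻¹ * 1ℚ                 ≡⟨ cong (x⁻¹ *_) (sym (½^n*2^n≡1 n)) ⟩
    x⁻¹ * (½ ^ℚ n * 2ⁿ)      ≤⟨ *-monoˡ-≤-nonNeg x⁻¹ {{nonNegative (0≤1/ x {{≢-nonZero x≢0}} (<⇒≤ (½^≤⇒pos n ½^n≤x)))}}
                                   (*-monoʳ-≤-nonNeg 2ⁿ {{nonNegative (0≤ℕ→ℚ (2 ℕ.^ n))}} ½^n≤x) ⟩
    x⁻¹ * (x * 2ⁿ)           ≡⟨ sym (*-assoc x⁻¹ x 2ⁿ) ⟩
    (x⁻¹ * x) * 2ⁿ           ≡⟨ cong (_* 2ⁿ) (*-inverseˡ x {{≢-nonZero x≢0}}) ⟩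
    1ℚ * 2ⁿ                  ≡⟨ *-identityˡ 2ⁿ ⟩
    2ⁿ                       ∎
    where
    open ≤-Reasoning
    2ⁿ = ℕ→ℚ (2 ℕ.^ n)
    x⁻¹ = 1/_ x {{≢-nonZero x≢0}}

module Rounding where

  open import Data.Nat as ℕ using (ℕ; suc)
  open import Data.Integer as ℤ using (ℤ; +_)
  import Data.Integer.Properties as ℤP
  open import Data.Integer.DivMod using (n<s[n/ℕd]*d; [n/ℕd]*d≤n; div-pos-is-/ℕ)
  open import Data.Rational
  open import Data.Rational.Properties using (drop-*≤*; ↥-neg; ↧-neg)
  open import Relation.Binary.PropositionalEquality
  open import Defs using (ℕ→ℚ; ℚ→ℕ)
  open RationalArithmetic using (ℕ→ℚ≡mkℚ)

  private
    ≤floor : ∀ p (i : ℤ) → i ℤ.* ↧ p ℤ.≤ ↥ p → i ℤ.≤ floor p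
    ≤floor p@(mkℚ n d _) i i*d≤n rewrite div-pos-is-/ℕ n (suc d) {{_}} =
      subst (i ℤ.≤_) (ℤP.pred-suc (n ℤ./ℕ suc d))
        (ℤP.i<j⇒i≤pred[j] {i} {ℤ.suc (n ℤ./ℕ suc d)} (ℤP.*-cancelʳ-<-nonNeg (+ suc d) (ℤP.≤-<-trans i*d≤n (n<s[n/ℕd]*d n (suc d)))))

    floor≤ : ∀ p (i : ℤ) → ↥ p ℤ.≤ i ℤ.* ↧ p → floor p ℤ.≤ i
    floor≤ p@(mkℚ n d _) i n≤i*d rewrite div-pos-is-/ℕ n (suc d) {{_}} =
      ℤP.*-cancelʳ-≤-pos (n ℤ./ℕ suc d) i (+ suc d) (ℤP.≤-trans ([n/ℕd]*d≤n n (suc d)) n≤i*d)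

    ↥≤c*↧ : ∀ {x} c → x ≤ ℕ→ℚ c → ↥ x ℤ.≤ + c ℤ.* ↧ x
    ↥≤c*↧ {x} c x≤c rewrite ℕ→ℚ≡mkℚ c = subst (ℤ._≤ + c ℤ.* ↧ x) (ℤP.*-identityʳ (↥ x)) (drop-*≤* x≤c)

    ceiling≡-floor- : ∀ p → ceiling p ≡ ℤ.- floor (- p)
    ceiling≡-floor- (mkℚ _ _ _) = refl

  ceiling≤ : ∀ {x} c → x ≤ ℕ→ℚ c → ceiling x ℤ.≤ + c
  ceiling≤ {x} c x≤c rewrite ceiling≡-floor- x =
    ℤP.≤-trans (ℤP.neg-mono-≤ (≤floor (- x) (ℤ.- (+ c)) -c*↧≤↥)) (ℤP.≤-reflexive (ℤP.neg-involutive (+ c)))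
    where
    -c*↧≤↥ : ℤ.- (+ c) ℤ.* ↧ (- x) ℤ.≤ ↥ (- x)
    -c*↧≤↥ = subst₂ ℤ._≤_ (trans (ℤP.neg-distribˡ-* (+ c) (↧ x)) (cong (ℤ.- (+ c) ℤ.*_) (sym (↧-neg x))))
      (sym (↥-neg x)) (ℤP.neg-mono-≤ (↥≤c*↧ c x≤c))

  -- ℚ→ℕ takes ∣⌊x⌋∣, so it is monotone only on non-negative x.
  ℚ→ℕ≤ : ∀ {x} c → 0ℚ ≤ x → x ≤ ℕ→ℚ c → ℚ→ℕ x ℕ.≤ c
  ℚ→ℕ≤ {x} c 0≤x x≤c = ℤP.drop‿+≤+ (subst (ℤ._≤ + c) (sym (ℤP.0≤i⇒+∣i∣≡i 0≤⌊x⌋)) (floor≤ x (+ c) (↥≤c*↧ c x≤c)))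
    where
    0≤⌊x⌋ : + 0 ℤ.≤ floor x
    0≤⌊x⌋ = ≤floor x (+ 0) (subst (+ 0 ℤ.* ↧ x ℤ.≤_) (ℤP.*-identityʳ (↥ x)) (drop-*≤* 0≤x))

module BoundOnT where

  open import Data.Nat as ℕ using (ℕ; zero; suc)
  import Data.Nat.Properties as ℕP
  open import Data.Nat.ListAction using (sum)
  open import Data.List using (map)
  open import Data.Rational
  open import Data.Rational.Properties
  open import Data.Rational.Solver using (module +-*-Solver)
  open +-*-Solver
  open import Relation.Binary.PropositionalEquality
  open import Defs using (ℕ→ℚ; ℤ→ℚ; _^ℚ_; inv; Σ'; εprime; T; range; prodRange)
  open ExponentialGrowth using (tExponent; 2^[1+N]*m[m∸1]*2^[[N+1]m]≤2^tExponent)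
  open RangeProducts using (sum-prodRange-suffix≤)
  open RationalArithmetic
  open Rounding using (ceiling≤)

  -- (e/4)^m = (e/2)^m ½^m, so the denominator is (e/2)^m · 2 (1 - ½^m) ≥ (e/2)^m.
  ½^≤Σ-denominator : ∀ {e} m N → ½ ^ℚ N ≤ e → 1 ℕ.≤ m →
    ½ ^ℚ ((N ℕ.+ 1) ℕ.* m) ≤ ℕ→ℚ 2 * (((e * ½) ^ℚ m) - ((e * (½ ^ℚ 2)) ^ℚ m))
  ½^≤Σ-denominator {e} m@(suc m-1) N ½^N≤e _ = begin
    ½ ^ℚ ((N ℕ.+ 1) ℕ.* m)         ≤⟨ ½^≤-^ (N ℕ.+ 1) m (½^≤-* N 1 ½^N≤e (≤-reflexive (*-identityʳ ½))) ⟩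
    A                              ≡⟨ sym (*-identityʳ A) ⟩
    A * 1ℚ                         ≤⟨ *-monoˡ-≤-nonNeg A {{nonNegative 0≤A}} 1≤2[1-½^m] ⟩
    A * (ℕ→ℚ 2 * (1ℚ - ½ ^ℚ m))    ≡⟨ solve 3 (λ A h t → A :* (t :* (con 1ℚ :- h)) := t :* (A :- A :* h)) refl A (½ ^ℚ m) (ℕ→ℚ 2) ⟩
    ℕ→ℚ 2 * (A - A * ½ ^ℚ m)       ≡⟨ cong (λ y → ℕ→ℚ 2 * (A - y)) (sym (^ℚ-distribʳ-* (e * ½) ½ m)) ⟩
    ℕ→ℚ 2 * (A - (e * ½ * ½) ^ℚ m) ≡⟨ cong (λ y → ℕ→ℚ 2 * (A - y ^ℚ m)) (sym e¼≡e½½) ⟩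
    ℕ→ℚ 2 * (A - (e * (½ ^ℚ 2)) ^ℚ m) ∎
    where
    open ≤-Reasoning
    A = (e * ½) ^ℚ m
    0≤A : 0ℚ ≤ A
    0≤A = ^ℚ-nonNeg m (<⇒≤ (0<p*q (½^≤⇒pos N ½^N≤e) 0<½))
    e¼≡e½½ : e * (½ ^ℚ 2) ≡ e * ½ * ½
    e¼≡e½½ = solve 2 (λ e h → e :* (h :* (h :* con 1ℚ)) := (e :* h) :* h) refl e ½
    1≤2[1-½^m] : 1ℚ ≤ ℕ→ℚ 2 * (1ℚ - ½ ^ℚ m)
    1≤2[1-½^m] = *-monoˡ-≤-nonNeg (ℕ→ℚ 2) {{nonNegative (0≤ℕ→ℚ 2)}} (+-monoʳ-≤ 1ℚ (neg-antimono-≤ (½^[1+n]≤½ m-1)))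

  2*inv*Σ≤2^tExponent : ∀ {e} m N → ½ ^ℚ N ≤ e → 1 ℕ.≤ m →
    ℕ→ℚ 2 * inv e * ℤ→ℚ (Σ' (e * (½ ^ℚ 2)) (e * ½) m) ≤ ℕ→ℚ (2 ℕ.^ tExponent N m)
  2*inv*Σ≤2^tExponent {e} m N ½^N≤e 1≤m = begin
    ℕ→ℚ 2 * inv e * ℤ→ℚ (Σ' (e * (½ ^ℚ 2)) (e * ½) m)
      ≤⟨ *-mono-≤-nonNeg (0≤p*q (0≤ℕ→ℚ 2) (inv-nonNeg (<⇒≤ (½^≤⇒pos N ½^N≤e)))) 2*inv≤ (0≤ℕ→ℚ c) Σ≤ ⟩
    ℕ→ℚ (2 ℕ.^ suc N) * ℕ→ℚ c  ≡⟨ sym (ℕ→ℚ-homo-* (2 ℕ.^ suc N) c) ⟩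
    ℕ→ℚ (2 ℕ.^ suc N ℕ.* c)    ≤⟨ ℕ→ℚ-mono-≤ (2^[1+N]*m[m∸1]*2^[[N+1]m]≤2^tExponent N m) ⟩
    ℕ→ℚ (2 ℕ.^ tExponent N m) ∎
    where
    open ≤-Reasoning
    K = (N ℕ.+ 1) ℕ.* m
    m[m∸1] = m ℕ.* (m ℕ.∸ 1)
    c = m[m∸1] ℕ.* 2 ℕ.^ K
    D = ℕ→ℚ 2 * (((e * ½) ^ℚ m) - ((e * (½ ^ℚ 2)) ^ℚ m))
    m[m∸1]/D≤c : ℕ→ℚ m[m∸1] * inv D ≤ ℕ→ℚ c
    m[m∸1]/D≤c = begin
      ℕ→ℚ m[m∸1] * inv D            ≤⟨ *-monoˡ-≤-nonNeg (ℕ→ℚ m[m∸1]) {{nonNegative (0≤ℕ→ℚ m[m∸1])}}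
                                         (inv≤2^ K (½^≤Σ-denominator m N ½^N≤e 1≤m)) ⟩
      ℕ→ℚ m[m∸1] * ℕ→ℚ (2 ℕ.^ K)    ≡⟨ sym (ℕ→ℚ-homo-* m[m∸1] (2 ℕ.^ K)) ⟩
      ℕ→ℚ c                         ∎
    Σ≤ : ℤ→ℚ (Σ' (e * (½ ^ℚ 2)) (e * ½) m) ≤ ℕ→ℚ c
    Σ≤ = ℤ→ℚ-≤-ℕ→ℚ c (ceiling≤ c m[m∸1]/D≤c)
    2*inv≤ : ℕ→ℚ 2 * inv e ≤ ℕ→ℚ (2 ℕ.^ suc N)
    2*inv≤ = subst (ℕ→ℚ 2 * inv e ≤_) (sym (ℕ→ℚ-homo-* 2 (2 ℕ.^ N)))
      (*-monoˡ-≤-nonNeg (ℕ→ℚ 2) {{nonNegative (0≤ℕ→ℚ 2)}} (inv≤2^ N ½^N≤e))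

  εprimeExponent : ℕ → (ℕ → ℕ) → ℕ → ℕ
  εprimeExponent N a j = (N ℕ.+ 2 ℕ.* j) ℕ.* prodRange a 0 j

  -- ε′ = ε ^ P * ½ ^ (2 * S) with P = ∏_{q<j} a_q and S = Σ_{l<j} ∏_{l≤q<j} a_q ≤ j * P.
  ½^≤εprime : ∀ {ε} a j N → ½ ^ℚ N ≤ ε → (∀ t → 1 ℕ.≤ a t) → ½ ^ℚ εprimeExponent N a j ≤ εprime ε a j
  ½^≤εprime a zero N ½^N≤ε _ = ≤-trans (½^-antimono-≤ (ℕP.≤-reflexive (sym (trans (ℕP.*-identityʳ _) (ℕP.+-identityʳ N))))) ½^N≤ε
  ½^≤εprime a j@(suc _) N ½^N≤ε 1≤a = ≤-trans (½^-antimono-≤ exponent≤) (½^≤-* (N ℕ.* P) (2 ℕ.* S) (½^≤-^ N P ½^N≤ε) ≤-refl)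
    where
    P = prodRange a 0 j
    S = sum (map (λ l → prodRange a l j) (range 0 j))
    exponent≤ : N ℕ.* P ℕ.+ 2 ℕ.* S ℕ.≤ εprimeExponent N a j
    exponent≤ = begin
      N ℕ.* P ℕ.+ 2 ℕ.* S            ≤⟨ ℕP.+-monoʳ-≤ (N ℕ.* P) (ℕP.*-monoʳ-≤ 2 (sum-prodRange-suffix≤ a j 1≤a)) ⟩
      N ℕ.* P ℕ.+ 2 ℕ.* (j ℕ.* P)    ≡⟨ cong (N ℕ.* P ℕ.+_) (sym (ℕP.*-assoc 2 j P)) ⟩
      N ℕ.* P ℕ.+ 2 ℕ.* j ℕ.* P      ≡⟨ sym (ℕP.*-distribʳ-+ P N (2 ℕ.* j)) ⟩
      (N ℕ.+ 2 ℕ.* j) ℕ.* P          ∎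
      where open ℕP.≤-Reasoning

  T≤2^tExponent : ∀ {ε} a j N → ½ ^ℚ N ≤ ε → (∀ t → 2 ℕ.≤ a t) →
    T ε a j ≤ ℕ→ℚ (2 ℕ.^ tExponent (εprimeExponent N a j) (a j))
  T≤2^tExponent a j N ½^N≤ε 2≤a =
    2*inv*Σ≤2^tExponent (a j) (εprimeExponent N a j) (½^≤εprime a j N ½^N≤ε 1≤a) (1≤a j)
    where
    1≤a : ∀ t → 1 ℕ.≤ a t
    1≤a t = ℕP.≤-trans (ℕ.s≤s ℕ.z≤n) (2≤a t)

module Grid where

  open import Data.Nat as ℕ using (ℕ; suc)
  import Data.Nat.Properties as ℕP
  open import Data.Rational
  open import Data.Rational.Properties
  open import Data.Rational.Solver using (module +-*-Solver)
  open +-*-Solver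
  open import Data.List using ([]; _∷_)
  open import Data.List.Membership.Propositional using (_∈_; find)
  open import Data.List.Membership.Propositional.Properties using (∈-map⁻; ∈-concatMap⁻)
  open import Data.List.Relation.Unary.Any using (here)
  open import Data.Product using (_×_; _,_; ∃)
  open import Data.Bool using (if_then_else_)
  open import Data.Empty using (⊥-elim)
  open import Relation.Nullary using (Dec; yes; no; does)
  open import Relation.Binary.PropositionalEquality
  open import Defs using (ℕ→ℚ; _^ℚ_; Δ; ΔPairs)
  open RationalArithmetic using (ℕ→ℚ-mono-≤; ℕ→ℚ-homo-+; 0≤½^)

  private
    ∈Δ⇒≡ : ∀ {s ε} → ε ∈ Δ s → ∃ λ i → ε ≡ ℕ→ℚ (suc i) * ½ ^ℚ s
    ∈Δ⇒≡ {s} ε∈ with ∈-map⁻ (λ i → ℕ→ℚ (suc i) * ½ ^ℚ s) ε∈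
    ... | i , _ , ε≡ = i , ε≡

    *½^-mono : ∀ s {a b} → a ℕ.≤ b → ℕ→ℚ a * ½ ^ℚ s ≤ ℕ→ℚ b * ½ ^ℚ s
    *½^-mono s a≤b = *-monoʳ-≤-nonNeg (½ ^ℚ s) {{nonNegative (0≤½^ s)}} (ℕ→ℚ-mono-≤ a≤b)

    ∈-if : ∀ {A P : Set} (d : Dec P) {p q : A} → p ∈ (if does d then q ∷ [] else []) → P × p ≡ q
    ∈-if (yes pf) (here p≡q) = pf , p≡q
    ∈-if (no _) ()

    ∈ΔPairs⇒ : ∀ {s θ ε} → (θ , ε) ∈ ΔPairs s → θ ∈ Δ s × ε ∈ Δ s × θ < ε
    ∈ΔPairs⇒ {s} θε∈ with find (∈-concatMap⁻ _ {xs = Δ s} θε∈)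
    ... | θ , θ∈ , θε∈′ with find (∈-concatMap⁻ _ {xs = Δ s} θε∈′)
    ...   | ε , ε∈ , θε∈″ with ∈-if (θ <? ε) θε∈″
    ...     | θ<ε , refl = θ∈ , ε∈ , θ<ε

    b*h≡[a+b]*h-a*h : ∀ a b h → b * h ≡ (a + b) * h - a * h
    b*h≡[a+b]*h-a*h = solve 3 (λ a b h → b :* h := (a :+ b) :* h :- a :* h) refl

  Δ-lower : ∀ {s ε} → ε ∈ Δ s → ½ ^ℚ s ≤ ε
  Δ-lower {s} ε∈ with ∈Δ⇒≡ {s} ε∈
  ... | i , ε≡ = subst₂ _≤_ (*-identityˡ (½ ^ℚ s)) (sym ε≡) (*½^-mono s {1} {suc i} (ℕ.s≤s ℕ.z≤n))

  Δ-gap : ∀ {s θ ε} → θ ∈ Δ s → ε ∈ Δ s → θ < ε → ½ ^ℚ s ≤ ε - θ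
  Δ-gap {s} {θ} {ε} θ∈ ε∈ θ<ε with ∈Δ⇒≡ {s} θ∈ | ∈Δ⇒≡ {s} ε∈
  ...   | i , θ≡ | j , ε≡ with j ℕ.≤? i
  ...     | yes j≤i = ⊥-elim (<-irrefl refl (<-≤-trans θ<ε (subst₂ _≤_ (sym ε≡) (sym θ≡) (*½^-mono s {suc j} {suc i} (ℕ.s≤s j≤i)))))
  ...     | no j≰i = begin
    ½ ^ℚ s                                          ≡⟨ sym (*-identityˡ (½ ^ℚ s)) ⟩
    1ℚ * ½ ^ℚ s                                     ≤⟨ *½^-mono s {1} {d} (ℕP.m<n⇒0<n∸m i<j) ⟩
    ℕ→ℚ d * ½ ^ℚ s                                  ≡⟨ b*h≡[a+b]*h-a*h (ℕ→ℚ (suc i)) (ℕ→ℚ d) (½ ^ℚ s) ⟩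
    (ℕ→ℚ (suc i) + ℕ→ℚ d) * ½ ^ℚ s - ℕ→ℚ (suc i) * ½ ^ℚ s ≡⟨ cong (λ x → x * ½ ^ℚ s - ℕ→ℚ (suc i) * ½ ^ℚ s) (sym (ℕ→ℚ-homo-+ (suc i) d)) ⟩
    ℕ→ℚ (suc i ℕ.+ d) * ½ ^ℚ s - ℕ→ℚ (suc i) * ½ ^ℚ s ≡⟨ cong (λ x → ℕ→ℚ (suc x) * ½ ^ℚ s - ℕ→ℚ (suc i) * ½ ^ℚ s) (ℕP.m+[n∸m]≡n (ℕP.<⇒≤ i<j)) ⟩
    ℕ→ℚ (suc j) * ½ ^ℚ s - ℕ→ℚ (suc i) * ½ ^ℚ s     ≡⟨ cong₂ _-_ (sym ε≡) (sym θ≡) ⟩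
    ε - θ                                           ∎
    where
    open ≤-Reasoning
    i<j = ℕP.≰⇒> j≰i
    d = j ℕ.∸ i

  ΔPairs-gap : ∀ {s θ ε} → (θ , ε) ∈ ΔPairs s → ½ ^ℚ s ≤ ε - θ
  ΔPairs-gap {s} θε∈ = let θ∈ , ε∈ , θ<ε = ∈ΔPairs⇒ {s} θε∈ in Δ-gap {s} θ∈ ε∈ θ<ε

module Unfolding where

  open import Data.Nat as ℕ using (ℕ; zero; suc)
  import Data.Nat.Properties as ℕP
  open import Data.Rational using (ℚ; 0ℚ; ½; _≤_)
  open import Data.Rational.Properties using (≤-refl; ≤-trans; ⊔-lub; p≤q⊔p)
  open import Data.List using (List; []; _∷_; map; concatMap)
  open import Data.List.Membership.Propositional using (_∈_; find)
  open import Data.List.Membership.Propositional.Properties using (∈-map⁻; ∈-concatMap⁻; ∈-upTo⁻)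
  open import Data.List.Relation.Unary.Any using (here; there)
  open import Data.Product using (_,_; proj₁; proj₂)
  open import Data.Bool using (true; false) renaming (T to True)
  open import Data.Unit using (tt)
  open import Data.Empty using (⊥-elim)
  open import Data.Sum using (inj₁; inj₂)
  open import Function using (_∘_)
  open import Relation.Binary.PropositionalEquality
  open import Defs using (_^ℚ_; maxList; range; prodRange; Δ; ΔPairs; T; Q; V; fPrev; f; ℚ→ℕ)

  maxList-nonNeg : ∀ xs → 0ℚ ≤ maxList xs
  maxList-nonNeg [] = ≤-refl
  maxList-nonNeg (x ∷ xs) = ≤-trans (maxList-nonNeg xs) (p≤q⊔p x (maxList xs))

  maxList≤ : ∀ xs {B} → 0ℚ ≤ B → (∀ {x} → x ∈ xs → x ≤ B) → maxList xs ≤ B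
  maxList≤ [] 0≤B _ = 0≤B
  maxList≤ (x ∷ xs) 0≤B xs≤B = ⊔-lub (xs≤B (here refl)) (maxList≤ xs 0≤B (xs≤B ∘ there))

  -- Projections rather than a pattern lambda, so that this is definitionally the list in V.
  Qterms : ℕ → (ℕ → ℕ) → ℕ → (ℕ → ℕ) → ℕ → List ℚ
  Qterms s m k n i = map (λ θε → Q (prodRange n 0 i) (proj₁ θε) (proj₂ θε) (λ q → m (i ℕ.+ q)) (k ℕ.∸ i)) (ΔPairs (s ℕ.+ k))

  V-nonNeg : ∀ s m k n → 0ℚ ≤ V s m k n
  V-nonNeg s m zero n = maxList-nonNeg (map (λ ε → T ε m 0) (Δ s))
  V-nonNeg s m k@(suc _) n =
    ≤-trans (maxList-nonNeg (concatMap (Qterms s m k n) (range 1 (suc k)))) (p≤q⊔p (T (½ ^ℚ s) m k) _)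

  fPrev≡ℚ→ℕ∘f : ∀ s m k q → q ℕ.< k → fPrev s m k q ≡ ℚ→ℕ (f s m q)
  fPrev≡ℚ→ℕ∘f s m (suc k) q q<1+k with q ℕ.<ᵇ k in q<ᵇk
  ... | true = fPrev≡ℚ→ℕ∘f s m k q (ℕP.<ᵇ⇒< q k (subst True (sym q<ᵇk) tt))
  ... | false with ℕP.m≤n⇒m<n∨m≡n (ℕP.≤-pred q<1+k)
  ...   | inj₁ q<k = ⊥-elim (subst True q<ᵇk (ℕP.<⇒<ᵇ q<k))
  ...   | inj₂ refl = refl

  V-zero≤ : ∀ s m n {B} → 0ℚ ≤ B → (∀ {ε} → ε ∈ Δ s → T ε m 0 ≤ B) → V s m 0 n ≤ B
  V-zero≤ s m n {B} 0≤B T≤B = maxList≤ (map (λ ε → T ε m 0) (Δ s)) 0≤B term≤B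
    where
    term≤B : ∀ {x} → x ∈ map (λ ε → T ε m 0) (Δ s) → x ≤ B
    term≤B x∈ with ∈-map⁻ (λ ε → T ε m 0) x∈
    ... | ε , ε∈ , refl = T≤B ε∈

  V-suc≤ : ∀ s m j n {B} → 0ℚ ≤ B → T (½ ^ℚ s) m (suc j) ≤ B →
    (∀ t → t ℕ.< suc j → ∀ {θ ε} → (θ , ε) ∈ ΔPairs (s ℕ.+ suc j) →
       Q (prodRange n 0 (suc t)) θ ε (λ q → m (suc t ℕ.+ q)) (suc j ℕ.∸ suc t) ≤ B) →
    V s m (suc j) n ≤ B
  V-suc≤ s m j n {B} 0≤B T≤B Q≤B = ⊔-lub T≤B (maxList≤ (concatMap (Qterms s m k n) (range 1 (suc k))) 0≤B term≤B)
    where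
    k = suc j
    term≤B : ∀ {x} → x ∈ concatMap (Qterms s m k n) (range 1 (suc k)) → x ≤ B
    term≤B x∈ with find (∈-concatMap⁻ (Qterms s m k n) {xs = range 1 (suc k)} x∈)
    ... | i , i∈ , x∈Qs with ∈-map⁻ (1 ℕ.+_) i∈ | ∈-map⁻ _ x∈Qs
    ...   | t , t∈ , refl | (θ , ε) , θε∈ , refl = Q≤B t (∈-upTo⁻ t∈) θε∈

open import Defs
open import Data.Nat using (ℕ; suc; _*_; _≤_; s≤s; z≤n)
open import Data.Rational using (ℚ; 0ℚ; ½) renaming (_≤_ to _≤ℚ_; _<_ to _<ℚ_; _*_ to _*ℚ_)
import Data.Rational.Properties as ℚP
open import Data.Empty using (⊥-elim)
open import Relation.Nullary.Decidable using (from-no)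

module MainInduction (s : ℕ) (m : ℕ → ℕ) (2≤s : 2 ≤ s) (2≤m : ∀ q → 2 ≤ m q) where

  open import Data.Nat
  open import Data.Nat.Properties
  open import Data.Nat.Induction using (<-rec)
  open import Data.Nat.Solver using (module +-*-Solver)
  open +-*-Solver
  open import Data.Rational using (_-_)
  open import Data.List.Membership.Propositional using (_∈_)
  open import Data.Product using (_,_)
  open import Function using (_∘_)
  open import Relation.Binary.PropositionalEquality
  open import Defs using (ℕ→ℚ; _^ℚ_; ℚ→ℕ; A₂iter; prodRange; ΔPairs; Q; fPrev; f)
  open ExponentialGrowth
  open RangeProducts
  open RationalArithmetic using (ℕ→ℚ-mono-≤; 0≤ℕ→ℚ; ½^≤-*; ½^≤-^)
  open Rounding using (ℚ→ℕ≤)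
  open BoundOnT using (εprimeExponent; T≤2^tExponent)
  open Grid using (Δ-lower; ΔPairs-gap)
  open Unfolding using (V-nonNeg; fPrev≡ℚ→ℕ∘f; V-zero≤; V-suc≤)

  z : ℕ → ℕ
  z k = 5 * s * prodRange m 0 k

  Bounded : ℕ → Set
  Bounded k = f s m k ≤ℚ ℕ→ℚ (A₂iter (suc k) (z (suc k)))

  1≤m : ∀ t → 1 ≤ m t
  1≤m t = ≤-trans (s≤s z≤n) (2≤m t)

  z[1+k]≡z*m : ∀ k → z (suc k) ≡ z k * m k
  z[1+k]≡z*m k = trans (cong (5 * s *_) (prodRange-suc m k)) (sym (*-assoc (5 * s) (prodRange m 0 k) (m k)))

  3+2s+4k≤z : ∀ k → 3 + 2 * s + 4 * k ≤ z k
  3+2s+4k≤z k = 3+2s+4k≤5*s*P k 2≤s (1+k≤prodRange m k 2≤m)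

  bounded-zero : Bounded 0
  bounded-zero = V-zero≤ s m (fPrev s m 0) (0≤ℕ→ℚ (A₂iter 1 (z 1))) λ ε∈ →
    ℚP.≤-trans (T≤2^tExponent m 0 s (Δ-lower {s} ε∈) 2≤m) (ℕ→ℚ-mono-≤ (^-monoʳ-≤ 2 exponent≤))
    where
    exponent≤ : tExponent (εprimeExponent s m 0) (m 0) ≤ z 1
    exponent≤ = subst₂ (λ N u → tExponent N (m 0) ≤ 5 * s * u)
      (sym (trans (*-identityʳ _) (+-identityʳ s))) (sym (*-identityʳ (m 0))) (tExponent≤5*s*u 2≤s (2≤m 0))

  module Step (j : ℕ) (IH : ∀ {q} → q < suc j → Bounded q) where

    k : ℕ
    k = suc j

    P : ℕ
    P = prodRange m 0 k

    M : ℕ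
    M = A₂iter k (z k)

    Mᵏ : ℕ
    Mᵏ = M ^ k

    B : ℚ
    B = ℕ→ℚ (A₂iter (suc k) (z (suc k)))

    10≤z : 10 ≤ z k
    10≤z = *-mono-≤ (*-monoʳ-≤ 5 2≤s) (prodRange-pos m 0 k 1≤m)

    1+k≤z : 1 + k ≤ z k
    1+k≤z = ≤-trans (s≤s (≤-trans (m≤n*m k 4) (m≤n+m (4 * k) (2 + 2 * s)))) (3+2s+4k≤z k)

    P≤z : P ≤ z k
    P≤z = m≤n*m P (5 * s) {{>-nonZero (≤-trans (s≤s z≤n) (*-monoʳ-≤ 5 2≤s))}}

    instance
      M≢0 : NonZero M
      M≢0 = >-nonZero (≤-trans (≤-trans (s≤s z≤n) 10≤z) (A₂iter-inflationary k (z k)))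

    z≤Mᵏ : z k ≤ Mᵏ
    z≤Mᵏ = ≤-trans (A₂iter-inflationary k (z k)) (m≤m*n M (M ^ j) {{m^n≢0 M j}})

    fPrev≤M : ∀ t → t < k → fPrev s m k t ≤ M
    fPrev≤M t t<k = begin
      fPrev s m k t              ≡⟨ fPrev≡ℚ→ℕ∘f s m k t t<k ⟩
      ℚ→ℕ (f s m t)              ≤⟨ ℚ→ℕ≤ _ (V-nonNeg s m t (fPrev s m t)) (IH t<k) ⟩
      A₂iter (suc t) (z (suc t)) ≤⟨ A₂iter-monoˡ-≤ (z (suc t)) t<k ⟩
      A₂iter k (z (suc t))       ≤⟨ A₂iter-monoʳ-≤ k (*-monoʳ-≤ (5 * s) (prodRange-prefix≤ m 1≤m t<k)) ⟩
      M                          ∎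
      where open ≤-Reasoning

    2^tExponent≤B : ∀ {c P′} → c ≤ 3 * Mᵏ → P′ ≤ z k → ℕ→ℚ (2 ^ tExponent (c * P′) (m k)) ≤ℚ B
    2^tExponent≤B {c} {P′} c≤ P′≤ = ℕ→ℚ-mono-≤ (^-monoʳ-≤ 2 (subst (tExponent (c * P′) (m k) ≤_) (cong (A₂iter k) (sym (z[1+k]≡z*m k)))
      (tExponent≤A₂iter j (2≤m k) 10≤z 1+k≤z (*-mono-≤ c≤ P′≤))))

    3+2s+4k≤Mᵏ : 3 + 2 * s + 4 * k ≤ Mᵏ
    3+2s+4k≤Mᵏ = ≤-trans (3+2s+4k≤z k) z≤Mᵏ

    T≤B : T (½ ^ℚ s) m k ≤ℚ B
    T≤B = ℚP.≤-trans (T≤2^tExponent m k s ℚP.≤-refl 2≤m) (2^tExponent≤B c≤ P≤z)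
      where
      s≤3+2s : s ≤ 3 + 2 * s
      s≤3+2s = ≤-trans (m≤n*m s 2) (m≤n+m (2 * s) 3)
      c≤ : s + 2 * k ≤ 3 * Mᵏ
      c≤ = ≤-trans (+-mono-≤ s≤3+2s (*-monoˡ-≤ k {2} {4} (s≤s (s≤s z≤n)))) (≤-trans 3+2s+4k≤Mᵏ (m≤n*m Mᵏ 3))

    Q≤B : ∀ t → t < k → ∀ {θ ε} → (θ , ε) ∈ ΔPairs (s + k) →
      Q (prodRange (fPrev s m k) 0 (suc t)) θ ε (λ q → m (suc t + q)) (k ∸ suc t) ≤ℚ B
    Q≤B t i≤k {θ} {ε} θε∈ = ℚP.≤-trans (T≤2^tExponent a′ j′ N₀ ½^N₀≤ε₀ (2≤m ∘ (i +_)))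
      (subst (λ u → ℕ→ℚ (2 ^ tExponent (εprimeExponent N₀ a′ j′) u) ≤ℚ B) (cong m (sym (m+[n∸m]≡n i≤k)))
        (2^tExponent≤B c≤ P′≤z))
      where
      i = suc t
      r = prodRange (fPrev s m k) 0 i
      a′ : ℕ → ℕ
      a′ q = m (i + q)
      j′ = k ∸ i
      N₀ = 3 + (s + k + r) * 2
      ½^N₀≤ε₀ : ½ ^ℚ N₀ ≤ℚ (½ ^ℚ 3) *ℚ (((ε - θ) *ℚ (½ ^ℚ r)) ^ℚ 2)
      ½^N₀≤ε₀ = ½^≤-* 3 ((s + k + r) * 2) ℚP.≤-refl (½^≤-^ (s + k + r) 2 (½^≤-* (s + k) r (ΔPairs-gap {s + k} θε∈) ℚP.≤-refl))
      r≤Mᵏ : r ≤ Mᵏ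
      r≤Mᵏ = ≤-trans (prodRange≤^ (fPrev s m k) i M (λ t′ t′<i → fPrev≤M t′ (<-≤-trans t′<i i≤k))) (^-monoʳ-≤ M i≤k)
      c≤ : N₀ + 2 * j′ ≤ 3 * Mᵏ
      c≤ = begin
        N₀ + 2 * j′                 ≤⟨ +-monoʳ-≤ N₀ (*-monoʳ-≤ 2 (m∸n≤m k i)) ⟩
        3 + (s + k + r) * 2 + 2 * k ≡⟨ solve 3 (λ s k r → con 3 :+ (s :+ k :+ r) :* con 2 :+ con 2 :* k
                                                          := (con 3 :+ con 2 :* s :+ con 4 :* k) :+ con 2 :* r) refl s k r ⟩
        3 + 2 * s + 4 * k + 2 * r   ≤⟨ +-mono-≤ 3+2s+4k≤Mᵏ (*-monoʳ-≤ 2 r≤Mᵏ) ⟩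
        3 * Mᵏ                      ∎
        where open ≤-Reasoning
      P′≤z : prodRange a′ 0 j′ ≤ z k
      P′≤z = ≤-trans (≤-reflexive (sym (prodRange-shift m i k))) (≤-trans (prodRange-suffix≤ m 1≤m i≤k) P≤z)

    bounded : Bounded k
    bounded = V-suc≤ s m j (fPrev s m k) (0≤ℕ→ℚ (A₂iter (suc k) (z (suc k)))) T≤B Q≤B

  bounded : ∀ k → Bounded k
  bounded = <-rec Bounded step
    where
    step : ∀ k → (∀ {q} → q < k → Bounded q) → Bounded k
    step zero _ = bounded-zero
    step (suc j) IH = Step.bounded j IH

2*½^s≤½⇒2≤s : ∀ s → ℕ→ℚ 2 *ℚ (½ ^ℚ s) ≤ℚ ½ → 2 ≤ s
2*½^s≤½⇒2≤s 0 2≤½ = ⊥-elim (from-no (ℕ→ℚ 2 *ℚ (½ ^ℚ 0) ℚP.≤? ½) 2≤½)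
2*½^s≤½⇒2≤s 1 1≤½ = ⊥-elim (from-no (ℕ→ℚ 2 *ℚ (½ ^ℚ 1) ℚP.≤? ½) 1≤½)
2*½^s≤½⇒2≤s (suc (suc s)) _ = s≤s (s≤s z≤n)

-- The hypotheses on δ serve only to force 2 ≤ s.
proposition4p3 : (δ : ℚ) (s : ℕ) (m : ℕ → ℕ)
    → 0ℚ <ℚ δ → δ ≤ℚ ½
    → (ℕ→ℚ 2 *ℚ (½ ^ℚ s)) ≤ℚ δ
    → (∀ q → 2 ≤ m q)
    → ∀ (k : ℕ) → f s m k ≤ℚ ℕ→ℚ (A₂iter (suc k) (5 * s * prodRange m 0 (suc k)))
proposition4p3 δ s m _ δ≤½ 2½^s≤δ 2≤m = MainInduction.bounded s m (2*½^s≤½⇒2≤s s (ℚP.≤-trans 2½^s≤δ δ≤½)) 2≤m
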